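{- Let $(\mathbb{C},P)$ be an elementary existential doctrine with singletons, let $A$ be an object of $\mathbb{C}$, and let $\eta_A:A\to S_A$ be the unique morphism with $\lfloor\sigma_A\rfloor\circ\eta_A=\{\delta_A\}$. Then, as formulas in $P(A\times S_A)$, $\delta_{S_A}(\eta_A(a),s)=a\in_A\lfloor\sigma_A\rfloor(s)$, i.e. $(\eta_A\times\mathrm{id}_{S_A})^*\delta_{S_A}=(\mathrm{id}_A\times\lfloor\sigma_A\rfloor)^*\in_A$.
   Context: A doctrine is a pair $(\mathbb{C},P)$ with $\mathbb{C}$ a category with finite products and $P:\mathbb{C}^{op}\to\mathbf{ISL}$ a functor into inf-semilattices; write $f^*=P(f)$, $\wedge$ for meets, $\top_A$ for the top of $P(A)$. It is elementary existential if each $f^*$ has a left adjoint $\exists_f$ satisfying Beck–Chevalley for pullbacks and Frobenius reciprocity $\exists_f(\alpha\wedge f^*\beta)=\exists_f\alpha\wedge\beta$. Equality on $A$: $\delta_A=\exists_{\Delta_A}\top_A\in P(A\times A)$. A comprehension of $\alpha\in P(A)$ is a morphism $\lfloor\alpha\rfloor:X\to A$ with $\top_X\le\lfloor\alpha\rfloor^*\alpha$ such that every $f:Y\to A$ with $\top_Y\le f^*\alpha$ factors uniquely as $f=\lfloor\alpha\rfloor\circ h$; a morphism $f:X\to Y$ has an image if $\exists_f\top_X$ has a comprehension. Power objects: for each $X$ an object $\mathbb{P}(X)$ and $\in_X\in P(X\times\mathbb{P}(X))$ such that for each $\gamma\in P(X\times Y)$ there is a unique $\{\gamma\}:Y\to\mathbb{P}(X)$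 with $\gamma=(\mathrm{id}_X\times\{\gamma\})^*\in_X$; we write $a\in_X g(y)$ for $(\mathrm{id}_X\times g)^*\in_X$. A formula $F\in P(Y\times A)$ is a functional relation from $Y$ to $A$ if $F(y,a)\wedge F(y,a')\le\delta_A(a,a')$ and $\exists a{:}A.\,F(y,a)=\top_Y$ (internal-language notation). A morphism $f:A\to B$ is internally injective if $\delta_A=(f\times f)^*\delta_B$. The doctrine has singletons if (i) it has power objects; (ii) for every $A$ the morphism $\{\delta_A\}:A\to\mathbb{P}(A)$ has an image and is internally injective; (iii) for every $g:Y\to\mathbb{P}(A)$, the formula $a\in_A g(y)$, read as a relation from $Y$ to $A$, is functional from $Y$ to $A$ iff $g^*(\exists_{\{\delta_A\}}\top_A)=\top_Y$. Write $\sigma_A=\exists_{\{\delta_A\}}\top_A$ and $\lfloor\sigma_A\rfloor:S_A\to\mathbb{P}(A)$ for its comprehension (so $\eta_A$ exists uniquely since $\{\delta_A\}^*\sigma_A=\top_A$). -}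

module Defs where

open import Level using (Level; _⊔_) renaming (suc to lsuc)
open import Relation.Binary.PropositionalEquality using (_≡_)
open import Data.Product using (Σ; _,_; proj₁; proj₂; Σ-syntax)
open import Function.Bundles using (_⇔_)

record FPCat (o ℓ : Level) : Set (lsuc (o ⊔ ℓ)) where
  infixr 9 _∘_
  infixr 7 _×_
  field
    Obj  : Set o
    Hom  : Obj → Obj → Set ℓ
    id   : ∀ {A} → Hom A A
    _∘_  : ∀ {A B C} → Hom B C → Hom A B → Hom A C
    identityˡ : ∀ {A B} (f : Hom A B) → id ∘ f ≡ f
    identityʳ : ∀ {A B} (f : Hom A B) → f ∘ id ≡ f
    assoc     : ∀ {A B C D} (h : Hom C D) (g : Hom B C) (f : Hom A B) →
                (h ∘ g) ∘ f ≡ h ∘ (g ∘ f)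
    𝟙    : Obj
    !    : ∀ {A} → Hom A 𝟙
    !-unique : ∀ {A} (f : Hom A 𝟙) → f ≡ !
    _×_  : Obj → Obj → Obj
    π₁   : ∀ {A B} → Hom (A × B) A
    π₂   : ∀ {A B} → Hom (A × B) B
    ⟨_,_⟩ : ∀ {X A B} → Hom X A → Hom X B → Hom X (A × B)
    π₁-β : ∀ {X A B} (f : Hom X A) (g : Hom X B) → π₁ ∘ ⟨ f , g ⟩ ≡ f
    π₂-β : ∀ {X A B} (f : Hom X A) (g : Hom X B) → π₂ ∘ ⟨ f , g ⟩ ≡ g
    ⟨⟩-unique : ∀ {X A B} (f : Hom X A) (g : Hom X B) (h : Hom X (A × B)) →
                π₁ ∘ h ≡ f → π₂ ∘ h ≡ g → h ≡ ⟨ f , g ⟩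

  Δ : ∀ {A} → Hom A (A × A)
  Δ = ⟨ id , id ⟩

  _⊗_ : ∀ {A B C D} → Hom A C → Hom B D → Hom (A × B) (C × D)
  f ⊗ g = ⟨ f ∘ π₁ , g ∘ π₂ ⟩

  swap : ∀ {A B} → Hom (A × B) (B × A)
  swap = ⟨ π₂ , π₁ ⟩

  record IsPullback {A B C' D : Obj} (f : Hom A B) (g : Hom C' B)
                    (p₁ : Hom D A) (p₂ : Hom D C') : Set (o ⊔ ℓ) where
    field
      commute   : f ∘ p₁ ≡ g ∘ p₂
      universal : ∀ {X} (h₁ : Hom X A) (h₂ : Hom X C') → f ∘ h₁ ≡ g ∘ h₂ →
                  Σ[ u ∈ Hom X D ] ((p₁ ∘ u ≡ h₁) Data.Product.× (p₂ ∘ u ≡ h₂))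
      unique    : ∀ {X} (u v : Hom X D) → p₁ ∘ u ≡ p₁ ∘ v → p₂ ∘ u ≡ p₂ ∘ v → u ≡ v

record Doctrine {o ℓ : Level} (C : FPCat o ℓ) (p q : Level)
       : Set (lsuc (o ⊔ ℓ ⊔ p ⊔ q)) where
  open FPCat C
  infix 4 _≤_
  infixr 6 _∧_
  field
    P    : Obj → Set p
    _≤_  : ∀ {A} → P A → P A → Set q
    ≤-refl    : ∀ {A} {α : P A} → α ≤ α
    ≤-trans   : ∀ {A} {α β γ : P A} → α ≤ β → β ≤ γ → α ≤ γ
    ≤-antisym : ∀ {A} {α β : P A} → α ≤ β → β ≤ α → α ≡ β
    ⊤    : ∀ {A} → P A
    ⊤-max : ∀ {A} (α : P A) → α ≤ ⊤
    _∧_  : ∀ {A} → P A → P A → P A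
    ∧-lb₁ : ∀ {A} (α β : P A) → α ∧ β ≤ α
    ∧-lb₂ : ∀ {A} (α β : P A) → α ∧ β ≤ β
    ∧-glb : ∀ {A} {α β γ : P A} → γ ≤ α → γ ≤ β → γ ≤ α ∧ β
    _*   : ∀ {A B} → Hom A B → P B → P A
    *-mono : ∀ {A B} (f : Hom A B) {α β : P B} → α ≤ β → (f *) α ≤ (f *) β
    *-⊤    : ∀ {A B} (f : Hom A B) → (f *) ⊤ ≡ ⊤
    *-∧    : ∀ {A B} (f : Hom A B) (α β : P B) → (f *) (α ∧ β) ≡ (f *) α ∧ (f *) β
    *-id   : ∀ {A} (α : P A) → (id *) α ≡ α
    *-∘    : ∀ {A B C'} (g : Hom B C') (f : Hom A B) (α : P C') →
             ((g ∘ f) *) α ≡ (f *) ((g *) α)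

record ExistentialDoctrine {o ℓ : Level} (C : FPCat o ℓ) (p q : Level)
       : Set (lsuc (o ⊔ ℓ ⊔ p ⊔ q)) where
  open FPCat C
  field
    doctrine : Doctrine C p q
  open Doctrine doctrine
  field
    ∃ : ∀ {A B} → Hom A B → P A → P B
    ∃⊣* : ∀ {A B} (f : Hom A B) (α : P A) (β : P B) → (∃ f α ≤ β) ⇔ (α ≤ (f *) β)
    beck-chevalley : ∀ {A B C' D} (f : Hom A B) (g : Hom C' B)
                     (p₁ : Hom D A) (p₂ : Hom D C') → IsPullback f g p₁ p₂ →
                     (α : P A) → (g *) (∃ f α) ≡ ∃ p₂ ((p₁ *) α)
    frobenius : ∀ {A B} (f : Hom A B) (α : P A) (β : P B) →
                ∃ f (α ∧ (f *) β) ≡ ∃ f α ∧ β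

  δ : ∀ A → P (A × A)
  δ A = ∃ Δ ⊤

  record IsComprehension {A X : Obj} (α : P A) (m : Hom X A) : Set (o ⊔ ℓ ⊔ q) where
    field
      inside    : ⊤ ≤ (m *) α
      factor    : ∀ {Y} (f : Hom Y A) → ⊤ ≤ (f *) α → Σ[ h ∈ Hom Y X ] (m ∘ h ≡ f)
      factor-unique : ∀ {Y} (h h' : Hom Y X) → m ∘ h ≡ m ∘ h' → h ≡ h'

  Comprehension : ∀ {A} → P A → Set (o ⊔ ℓ ⊔ q)
  Comprehension {A} α = Σ[ X ∈ Obj ] Σ[ m ∈ Hom X A ] IsComprehension α m

  HasImage : ∀ {A B} → Hom A B → Set (o ⊔ ℓ ⊔ q)
  HasImage f = Comprehension (∃ f ⊤)

  InternallyInjective : ∀ {A B} → Hom A B → Set p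
  InternallyInjective {A} {B} f = δ A ≡ ((f ⊗ f) *) (δ B)

  -- F ∈ P(Y × A) is a functional relation from Y to A:
  --   F(y,a) ∧ F(y,a') ≤ δ_A(a,a')   in context (Y × A) × A
  --   ∃ a. F(y,a) = ⊤_Y
  record Functional {Y A : Obj} (F : P (Y × A)) : Set (p ⊔ q) where
    field
      single : (π₁ *) F ∧ (⟨ π₁ ∘ π₁ , π₂ ⟩ *) F ≤ (⟨ π₂ ∘ π₁ , π₂ ⟩ *) (δ A)
      total  : ∃ π₁ F ≡ ⊤

record PowerObjects {o ℓ p q : Level} {C : FPCat o ℓ}
       (D : ExistentialDoctrine C p q) : Set (o ⊔ ℓ ⊔ p ⊔ q) where
  open FPCat C
  open ExistentialDoctrine D
  open Doctrine doctrine
  field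
    ℙ    : Obj → Obj
    ∈    : ∀ X → P (X × ℙ X)
    ｛_｝ : ∀ {X Y} → P (X × Y) → Hom Y (ℙ X)
    ｛｝-spec   : ∀ {X Y} (γ : P (X × Y)) → γ ≡ ((id ⊗ ｛ γ ｝) *) (∈ X)
    ｛｝-unique : ∀ {X Y} (γ : P (X × Y)) (g : Hom Y (ℙ X)) →
                 γ ≡ ((id ⊗ g) *) (∈ X) → g ≡ ｛ γ ｝

  σ : ∀ A → P (ℙ A)
  σ A = ∃ ｛ δ A ｝ ⊤

record Singletons {o ℓ p q : Level} {C : FPCat o ℓ}
       (D : ExistentialDoctrine C p q) : Set (o ⊔ ℓ ⊔ p ⊔ q) where
  open FPCat C
  open ExistentialDoctrine D
  open Doctrine doctrine
  field
    powerObjects : PowerObjects D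
  open PowerObjects powerObjects
  field
    image     : ∀ A → HasImage ｛ δ A ｝
    injective : ∀ A → InternallyInjective ｛ δ A ｝
    -- a ∈_A g(y), read as a relation from Y to A (hence the swap)
    functional⇔ : ∀ {Y A} (g : Hom Y (ℙ A)) →
                  Functional ((swap *) (((id ⊗ g) *) (∈ A))) ⇔ ((g *) (σ A) ≡ ⊤)

module Submission where

-- Write L and R for the two sides and m = ⌊σ_A⌋.  The proof has two halves.
--
-- * L ≤ R.  Reindexing equality along f ⊗ id is the existential image of
--   the graph ⟨id , f⟩ (Beck–Chevalley for the graph pullback), so L ≤ R
--   amounts to ⊤ ≤ ⟨id , η⟩* R = δ_A(a,a), which holds.
-- * R ≤ L.  Since m is a comprehension of σ_A = ∃_{{δ_A}} ⊤ and
--   m ∘ η = {δ_A}, the map η is surjective (∃_η ⊤ = ⊤), hence so is id ⊗ η,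
--   and reindexing along a surjection reflects ≤ (Frobenius).  Along id ⊗ η
--   the formula R becomes δ_A, and L becomes δ_{S_A}(η a, η a'), which
--   every morphism preserves.

open import Defs
open import Level using (Level)
open import Relation.Binary.PropositionalEquality
  using (_≡_; refl; sym; trans; cong; cong₂; subst; module ≡-Reasoning)
open import Data.Product using (_,_; proj₁; proj₂) renaming (_×_ to _∧ₚ_)
open import Function.Bundles using (Equivalence)

module ProductCalculus {o ℓ : Level} (C : FPCat o ℓ) where
  open FPCat C
  open ≡-Reasoning

  pair-ext : ∀ {X A B} (u v : Hom X (A × B)) →
             π₁ ∘ u ≡ π₁ ∘ v → π₂ ∘ u ≡ π₂ ∘ v → u ≡ v
  pair-ext u v e₁ e₂ =
    trans (⟨⟩-unique _ _ u refl refl) (sym (⟨⟩-unique _ _ v (sym e₁) (sym e₂)))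

  pair-η : ∀ {X A B} (u : Hom X (A × B)) → ⟨ π₁ ∘ u , π₂ ∘ u ⟩ ≡ u
  pair-η u = sym (⟨⟩-unique _ _ u refl refl)

  ⟨⟩-injective : ∀ {X A B} {f f' : Hom X A} {g g' : Hom X B} →
                 ⟨ f , g ⟩ ≡ ⟨ f' , g' ⟩ → (f ≡ f') ∧ₚ (g ≡ g')
  ⟨⟩-injective {f = f} {f'} {g} {g'} e =
    trans (sym (π₁-β f g)) (trans (cong (π₁ ∘_) e) (π₁-β f' g')) ,
    trans (sym (π₂-β f g)) (trans (cong (π₂ ∘_) e) (π₂-β f' g'))

  ⟨⟩∘ : ∀ {X Y A B} (f : Hom Y A) (g : Hom Y B) (h : Hom X Y) →
        ⟨ f , g ⟩ ∘ h ≡ ⟨ f ∘ h , g ∘ h ⟩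
  ⟨⟩∘ f g h = ⟨⟩-unique _ _ _
    (trans (sym (assoc _ _ _)) (cong (_∘ h) (π₁-β f g)))
    (trans (sym (assoc _ _ _)) (cong (_∘ h) (π₂-β f g)))

  Δ∘ : ∀ {X A} (h : Hom X A) → Δ ∘ h ≡ ⟨ h , h ⟩
  Δ∘ h = trans (⟨⟩∘ id id h) (cong₂ ⟨_,_⟩ (identityˡ h) (identityˡ h))

  ⊗∘⟨⟩ : ∀ {X A B A' B'} (a : Hom A A') (b : Hom B B') (f : Hom X A) (g : Hom X B) →
         (a ⊗ b) ∘ ⟨ f , g ⟩ ≡ ⟨ a ∘ f , b ∘ g ⟩
  ⊗∘⟨⟩ a b f g = trans (⟨⟩∘ _ _ _) (cong₂ ⟨_,_⟩
    (trans (assoc _ _ _) (cong (a ∘_) (π₁-β f g)))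
    (trans (assoc _ _ _) (cong (b ∘_) (π₂-β f g))))

  ⊗∘ : ∀ {X A B A' B'} (a : Hom A A') (b : Hom B B') (h : Hom X (A × B)) →
       (a ⊗ b) ∘ h ≡ ⟨ a ∘ (π₁ ∘ h) , b ∘ (π₂ ∘ h) ⟩
  ⊗∘ a b h = trans (cong ((a ⊗ b) ∘_) (sym (pair-η h))) (⊗∘⟨⟩ a b _ _)

  ⊗∘⊗ : ∀ {A B A' B' A'' B''} (a : Hom A' A'') (b : Hom B' B'') (c : Hom A A') (d : Hom B B') →
        (a ⊗ b) ∘ (c ⊗ d) ≡ (a ∘ c) ⊗ (b ∘ d)
  ⊗∘⊗ a b c d = trans (⊗∘⟨⟩ a b (c ∘ π₁) (d ∘ π₂))
                      (cong₂ ⟨_,_⟩ (sym (assoc _ _ _)) (sym (assoc _ _ _)))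

  π₁∘id⊗ : ∀ {X A B} (f : Hom A B) → π₁ ∘ (id {X} ⊗ f) ≡ π₁
  π₁∘id⊗ f = trans (π₁-β _ _) (identityˡ _)

  mono-kernel-pair : ∀ {A B} (m : Hom A B) →
                     (∀ {X} (h h' : Hom X A) → m ∘ h ≡ m ∘ h' → h ≡ h') →
                     IsPullback m m id id
  mono-kernel-pair m mono = record
    { commute   = refl
    ; universal = λ h₁ h₂ e → h₁ , identityˡ h₁ , trans (identityˡ h₁) (mono h₁ h₂ e)
    ; unique    = λ u v e _ → trans (sym (identityˡ u)) (trans e (identityˡ v))
    }

  product-pullback : ∀ {X A B} (f : Hom A B) →
                     IsPullback {A} {B} {X × B} {X × A} f π₂ π₂ (id ⊗ f)
  product-pullback f = record
    { commute   = sym (π₂-β _ _)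
    ; universal = λ h₁ h₂ e → ⟨ π₁ ∘ h₂ , h₁ ⟩ , π₂-β _ _ ,
        (begin
          (id ⊗ f) ∘ ⟨ π₁ ∘ h₂ , h₁ ⟩  ≡⟨ ⊗∘⟨⟩ id f _ h₁ ⟩
          ⟨ id ∘ (π₁ ∘ h₂) , f ∘ h₁ ⟩  ≡⟨ cong₂ ⟨_,_⟩ (identityˡ _) e ⟩
          ⟨ π₁ ∘ h₂ , π₂ ∘ h₂ ⟩        ≡⟨ pair-η h₂ ⟩
          h₂                           ∎)
    ; unique    = λ u v e₂ e₁ → pair-ext u v
        (begin
          π₁ ∘ u                 ≡⟨ cong (_∘ u) (sym (π₁∘id⊗ f)) ⟩
          (π₁ ∘ (id ⊗ f)) ∘ u    ≡⟨ assoc _ _ _ ⟩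
          π₁ ∘ ((id ⊗ f) ∘ u)    ≡⟨ cong (π₁ ∘_) e₁ ⟩
          π₁ ∘ ((id ⊗ f) ∘ v)    ≡⟨ sym (assoc _ _ _) ⟩
          (π₁ ∘ (id ⊗ f)) ∘ v    ≡⟨ cong (_∘ v) (π₁∘id⊗ f) ⟩
          π₁ ∘ v                 ∎)
        e₂
    }

  graph-pullback : ∀ {A B} (f : Hom A B) →
                   IsPullback {B} {B × B} {A × B} {A} Δ (f ⊗ id) f ⟨ id , f ⟩
  graph-pullback f = record
    { commute   = trans (Δ∘ f)
                   (trans (cong₂ ⟨_,_⟩ (sym (identityʳ f)) (sym (identityˡ f)))
                          (sym (⊗∘⟨⟩ f id id f)))
    ; universal = λ h₁ h₂ e →
        let components = ⟨⟩-injective (trans (sym (Δ∘ h₁)) (trans e (⊗∘ f id h₂)))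
            f∘u≡h₁ = sym (proj₁ components)
            h₁≡π₂h₂ = trans (proj₂ components) (identityˡ _)
        in π₁ ∘ h₂ , f∘u≡h₁ ,
           (begin
             ⟨ id , f ⟩ ∘ (π₁ ∘ h₂)           ≡⟨ ⟨⟩∘ id f _ ⟩
             ⟨ id ∘ (π₁ ∘ h₂) , f ∘ (π₁ ∘ h₂) ⟩ ≡⟨ cong₂ ⟨_,_⟩ (identityˡ _)
                                                         (trans f∘u≡h₁ h₁≡π₂h₂) ⟩
             ⟨ π₁ ∘ h₂ , π₂ ∘ h₂ ⟩             ≡⟨ pair-η h₂ ⟩
             h₂                               ∎)
    ; unique    = λ u v _ e →
        let π₁⟨id,f⟩∘ : ∀ w → π₁ ∘ (⟨ id , f ⟩ ∘ w) ≡ w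
            π₁⟨id,f⟩∘ w = trans (sym (assoc _ _ _))
                                (trans (cong (_∘ w) (π₁-β id f)) (identityˡ w))
        in trans (sym (π₁⟨id,f⟩∘ u)) (trans (cong (π₁ ∘_) e) (π₁⟨id,f⟩∘ v))
    }

module ExistentialCalculus {o ℓ p q : Level} {C : FPCat o ℓ}
                           (D : ExistentialDoctrine C p q) where
  open FPCat C
  open ExistentialDoctrine D
  open Doctrine doctrine
  open ProductCalculus C

  ≡⇒≤ : ∀ {X} {α β : P X} → α ≡ β → α ≤ β
  ≡⇒≤ {α = α} e = subst (α ≤_) e ≤-refl

  unit : ∀ {X Y} (f : Hom X Y) (α : P X) → α ≤ (f *) (∃ f α)
  unit f α = Equivalence.to (∃⊣* f α (∃ f α)) ≤-refl

  transpose : ∀ {X Y} (f : Hom X Y) {α : P X} {β : P Y} → α ≤ (f *) β → ∃ f α ≤ β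
  transpose f {α} {β} = Equivalence.from (∃⊣* f α β)

  reindex-∘ : ∀ {X Y Z} {f : Hom Y Z} {g : Hom X Y} {h : Hom X Z} →
              f ∘ g ≡ h → (α : P Z) → (g *) ((f *) α) ≡ (h *) α
  reindex-∘ {f = f} {g} e α = trans (sym (*-∘ f g α)) (cong (λ k → (k *) α) e)

  ∃-∘ : ∀ {X Y Z} (g : Hom Y Z) (f : Hom X Y) (α : P X) → ∃ (g ∘ f) α ≤ ∃ g (∃ f α)
  ∃-∘ g f α = transpose (g ∘ f)
    (≤-trans (unit f α) (≤-trans (*-mono f (unit g (∃ f α))) (≡⇒≤ (sym (*-∘ g f _)))))

  -- Along a monomorphism, ∃ followed by reindexing is deflationary
  -- (Beck–Chevalley for the trivial kernel pair).
  mono-∃ : ∀ {A B} (m : Hom A B) →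
           (∀ {X} (h h' : Hom X A) → m ∘ h ≡ m ∘ h' → h ≡ h') →
           (β : P A) → (m *) (∃ m β) ≤ β
  mono-∃ m mono β =
    ≤-trans (≡⇒≤ (beck-chevalley m m id id (mono-kernel-pair m mono) β))
            (transpose id ≤-refl)

  Surjective : ∀ {A B} → Hom A B → Set p
  Surjective f = ∃ f ⊤ ≡ ⊤

  corestriction-surjective : ∀ {A B I} {g : Hom A B} {m : Hom I B} (e : Hom A I) →
                             IsComprehension (∃ g ⊤) m → m ∘ e ≡ g → Surjective e
  corestriction-surjective {g = g} {m} e isC m∘e≡g = ≤-antisym (⊤-max _)
    (≤-trans inside
      (≤-trans (*-mono m (subst (λ k → ∃ k ⊤ ≤ ∃ m (∃ e ⊤)) m∘e≡g (∃-∘ m e ⊤)))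
               (mono-∃ m factor-unique (∃ e ⊤))))
    where open IsComprehension isC

  surjective-⊗ : ∀ {X A B} {f : Hom A B} → Surjective f → Surjective (id {X} ⊗ f)
  surjective-⊗ {f = f} surj = begin
    ∃ (id ⊗ f) ⊤             ≡⟨ cong (∃ (id ⊗ f)) (sym (*-⊤ π₂)) ⟩
    ∃ (id ⊗ f) ((π₂ *) ⊤)    ≡⟨ sym (beck-chevalley f π₂ π₂ (id ⊗ f) (product-pullback f) ⊤) ⟩
    (π₂ *) (∃ f ⊤)           ≡⟨ cong (π₂ *) surj ⟩
    (π₂ *) ⊤                 ≡⟨ *-⊤ π₂ ⟩
    ⊤                        ∎
    where open ≡-Reasoning

  -- Reindexing along a surjection reflects the order (by Frobenius:
  -- α = ∃_f ⊤ ∧ α = ∃_f (f* α)).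
  surjective-reflects-≤ : ∀ {A B} {f : Hom A B} → Surjective f →
                          {α β : P B} → (f *) α ≤ (f *) β → α ≤ β
  surjective-reflects-≤ {f = f} surj {α} {β} f*α≤f*β =
    ≤-trans (∧-glb (≤-trans (⊤-max α) (≡⇒≤ (sym surj))) (≤-refl {α = α}))
      (≤-trans (≡⇒≤ (sym (frobenius f ⊤ α)))
               (transpose f (≤-trans (∧-lb₂ _ _) f*α≤f*β)))

  δ-preserved : ∀ {A B} (f : Hom A B) → δ A ≤ ((f ⊗ f) *) (δ B)
  δ-preserved f = transpose Δ
    (≤-trans (≡⇒≤ (sym (*-⊤ f)))
      (≤-trans (*-mono f (unit Δ ⊤))
        (≡⇒≤ (trans (reindex-∘ (Δ∘ f) (δ _))
                    (sym (reindex-∘ (trans (⊗∘⟨⟩ f f id id)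
                            (cong₂ ⟨_,_⟩ (identityʳ f) (identityʳ f))) (δ _)))))))

  δ-graph : ∀ {A B} (f : Hom A B) → ((f ⊗ id) *) (δ B) ≡ ∃ ⟨ id , f ⟩ ⊤
  δ-graph f = trans (beck-chevalley Δ (f ⊗ id) f ⟨ id , f ⟩ (graph-pullback f) ⊤)
                    (cong (∃ ⟨ id , f ⟩) (*-⊤ f))

lemma4p4 : ∀ {o ℓ p q : Level} (C : FPCat o ℓ) (D : ExistentialDoctrine C p q)
           (S : Singletons D) (A : FPCat.Obj C)
           (SA : FPCat.Obj C) (m : FPCat.Hom C SA (PowerObjects.ℙ (Singletons.powerObjects S) A))
           (isC : ExistentialDoctrine.IsComprehension D (PowerObjects.σ (Singletons.powerObjects S) A) m)
           (η : FPCat.Hom C A SA)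
           → FPCat._∘_ C m η ≡ PowerObjects.｛_｝ (Singletons.powerObjects S) (ExistentialDoctrine.δ D A)
           → Doctrine._* (ExistentialDoctrine.doctrine D) (FPCat._⊗_ C η (FPCat.id C)) (ExistentialDoctrine.δ D SA)
             ≡ Doctrine._* (ExistentialDoctrine.doctrine D) (FPCat._⊗_ C (FPCat.id C) m) (PowerObjects.∈ (Singletons.powerObjects S) A)
lemma4p4 C D S A SA m isC η m∘η≡｛δ｝ = ≤-antisym L≤R R≤L
  where
    open FPCat C
    open ExistentialDoctrine D
    open Doctrine doctrine
    open PowerObjects (Singletons.powerObjects S)
    open ProductCalculus C
    open ExistentialCalculus D

    R-on-graph : ((⟨ id , η ⟩) *) (((id ⊗ m) *) (∈ A)) ≡ (Δ *) (δ A)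
    R-on-graph = trans (reindex-∘ (trans (⊗∘⟨⟩ id m id η) (cong₂ ⟨_,_⟩ refl m∘η≡｛δ｝)) (∈ A))
      (trans (sym (reindex-∘ (trans (⊗∘⟨⟩ id ｛ δ A ｝ id id) (cong₂ ⟨_,_⟩ refl (identityʳ _))) (∈ A)))
             (cong (Δ *) (sym (｛｝-spec (δ A)))))

    L≤R : ((η ⊗ id) *) (δ SA) ≤ ((id ⊗ m) *) (∈ A)
    L≤R = ≤-trans (≡⇒≤ (δ-graph η))
      (transpose ⟨ id , η ⟩ (≤-trans (unit Δ ⊤) (≡⇒≤ (sym R-on-graph))))

    R-along-η : ((id ⊗ η) *) (((id ⊗ m) *) (∈ A)) ≡ δ A
    R-along-η = trans (reindex-∘ (trans (⊗∘⊗ id m id η) (cong₂ _⊗_ (identityˡ id) m∘η≡｛δ｝)) (∈ A))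
                      (sym (｛｝-spec (δ A)))

    L-along-η : ((id ⊗ η) *) (((η ⊗ id) *) (δ SA)) ≡ ((η ⊗ η) *) (δ SA)
    L-along-η = reindex-∘ (trans (⊗∘⊗ η id id η) (cong₂ _⊗_ (identityʳ η) (identityˡ η))) (δ SA)

    R≤L : ((id ⊗ m) *) (∈ A) ≤ ((η ⊗ id) *) (δ SA)
    R≤L = surjective-reflects-≤ (surjective-⊗ (corestriction-surjective η isC m∘η≡｛δ｝))
      (≤-trans (≡⇒≤ R-along-η) (≤-trans (δ-preserved η) (≡⇒≤ (sym L-along-η))))
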